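{- Let $(S,I,O,\to)$ be an LTS with inputs and outputs, $R\subseteq S\times S$ and $p,q\in S$. Consider variables $\{X_r\mid r\in S\}$ and the environment $\sigma_R$ with $\sigma_R(X_r)=\{p'\mid (p',r)\in R\}$. Then $(p,q)\in\mathcal F_{io}(R)$ if and only if $$(\sigma_R,p)\models \bigwedge_{a?\in\mathsf{ins}(q)}[\![a?]\!]\bigvee_{q\xrightarrow{a?}q'}X_{q'}\ \wedge\ \bigwedge_{a!\in O}[a!]\bigvee_{q\xrightarrow{a!}q'}X_{q'}.$$
   Context: Actions: disjoint finite sets $I$ (inputs $a?$) and $O$ (outputs $a!$, including quiescence $\delta!$). An LTS with inputs and outputs is $(S,I,O,\to)$ with $\to\subseteq S\times(I\cup O)\times S$ such that $p\xrightarrow{\delta!}p'$ iff $p=p'$ and $p$ has no $a!$-transition for $a!\in O\setminus\{\delta!\}$; LTSs are image-finite, so the conjunctions and disjunctions above are finite; an empty disjunction denotes $\mathrm{ff}$ and an empty conjunction $\mathrm{tt}$. $\mathsf{ins}(p)$ is the set of inputs $a?$ such that $p$ has an $a?$-transition. $\mathcal F_{io}(R)$ is the set of pairs $(p,q)$ such that: (1) $\mathsf{ins}(q)\subseteq\mathsf{ins}(p)$; (2) for every $a?\in\mathsf{ins}(q)$, if $p\xrightarrow{a?}p'$ then there is $q'$ with $q\xrightarrow{a?}q'$ and $(p',q')\in R$; (3) for every $o!\in O$, if $p\xrightarrow{o!}p'$ then there is $q'$ with $q\xrightarrow{o!}q'$ and $(p',q')\in R$. Satisfaction relative to an environment $\sigma$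 mapping variables to subsets of $S$: $(\sigma,p)\models X$ iff $p\in\sigma(X)$; Boolean connectives as usual; $(\sigma,p)\models[a!]\phi$ iff $(\sigma,p')\models\phi$ for all $p\xrightarrow{a!}p'$; $(\sigma,p)\models[\![a?]\!]\phi$ iff $p$ has an $a?$-transition and $(\sigma,p')\models\phi$ for all $p\xrightarrow{a?}p'$. -}

module Defs where

open import Data.Bool using (Bool; true; false)
open import Data.Empty using (⊥)
open import Data.Unit using (⊤)
open import Data.Product using (Σ; ∃; _×_; _,_)
open import Data.Sum using (_⊎_; inj₁; inj₂)
open import Data.List using (List; []; _∷_; foldr; map; filterᵇ)
open import Data.List.Membership.Propositional using (_∈_)
open import Relation.Binary.PropositionalEquality using (_≡_; _≢_)
open import Relation.Nullary using (¬_)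

Act : Set → Set → Set
Act I O = I ⊎ O

record IOLTS : Set₁ where
  field
    S     : Set
    I     : Set
    O     : Set
    δ     : O
    Ienum : List I
    Ienum-complete : ∀ a → a ∈ Ienum
    Oenum : List O
    Oenum-complete : ∀ o → o ∈ Oenum
    _⟶[_]_ : S → Act I O → S → Set
    -- image-finiteness: successor lists for each state and action
    succs : S → Act I O → List S
    succs-sound    : ∀ p a p' → p' ∈ succs p a → p ⟶[ a ] p'
    succs-complete : ∀ p a p' → p ⟶[ a ] p' → p' ∈ succs p a
    quiescence⇒ : ∀ p p' → p ⟶[ inj₂ δ ] p' →
                  (p ≡ p') × (∀ o → o ≢ δ → ∀ p'' → ¬ (p ⟶[ inj₂ o ] p''))
    quiescence⇐ : ∀ p p' → (p ≡ p') × (∀ o → o ≢ δ → ∀ p'' → ¬ (p ⟶[ inj₂ o ] p'')) →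
                  p ⟶[ inj₂ δ ] p'

module _ (L : IOLTS) where
  open IOLTS L

  HasIn : S → I → Set
  HasIn p a = ∃ λ p' → p ⟶[ inj₁ a ] p'

  nonEmpty : List S → Bool
  nonEmpty []      = false
  nonEmpty (_ ∷ _) = true

  ins : S → List I
  ins p = filterᵇ (λ a → nonEmpty (succs p (inj₁ a))) Ienum

  Fio : (S → S → Set) → S → S → Set
  Fio R p q =
      (∀ a → HasIn q a → HasIn p a)
    × (∀ a → HasIn q a → ∀ p' → p ⟶[ inj₁ a ] p' →
         ∃ λ q' → (q ⟶[ inj₁ a ] q') × R p' q')
    × (∀ o p' → p ⟶[ inj₂ o ] p' →
         ∃ λ q' → (q ⟶[ inj₂ o ] q') × R p' q')

  data Form (V : Set) : Set where
    var  : V → Form V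
    tt ff : Form V
    ¬'_  : Form V → Form V
    _∧'_ _∨'_ : Form V → Form V → Form V
    [_!]_  : O → Form V → Form V
    ⟦_?⟧_  : I → Form V → Form V

  ⋀ : {V : Set} → List (Form V) → Form V
  ⋀ = foldr _∧'_ tt

  ⋁ : {V : Set} → List (Form V) → Form V
  ⋁ = foldr _∨'_ ff

  sat : {V : Set} → (V → S → Set) → S → Form V → Set
  sat σ p (var X)   = σ X p
  sat σ p tt        = ⊤
  sat σ p ff        = ⊥
  sat σ p (¬' φ)    = ¬ sat σ p φ
  sat σ p (φ ∧' ψ)  = sat σ p φ × sat σ p ψ
  sat σ p (φ ∨' ψ)  = sat σ p φ ⊎ sat σ p ψ
  sat σ p ([ a !] φ) = ∀ p' → p ⟶[ inj₂ a ] p' → sat σ p' φ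
  sat σ p (⟦ a ?⟧ φ) = HasIn p a × (∀ p' → p ⟶[ inj₁ a ] p' → sat σ p' φ)

  σR : (S → S → Set) → S → S → Set
  σR R r p' = R p' r

  charIO : S → Form S
  charIO q =
      ⋀ (map (λ a → ⟦ a ?⟧ ⋁ (map var (succs q (inj₁ a)))) (ins q))
    ∧' ⋀ (map (λ a → [ a !] ⋁ (map var (succs q (inj₂ a)))) Oenum)

-- The characteristic formula transcribes the three clauses of F_io. Under σ_R
-- the disjunction ⋁_{q -a-> q'} X_{q'} holds at p' exactly when p' is R-related
-- to some a-successor of q. The conjunct [[a?]] for a? ∈ ins(q) then carries both
-- clause (1), through its requirement that p has an a?-transition, and clause (2);
-- the conjuncts [a!] give clause (3).
module Submission where

open import Defs
open import Data.Product using (_×_; _,_; ∃; proj₁; proj₂)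
open import Data.Sum using (inj₁; inj₂)
open import Data.Unit using (tt)
open import Data.Bool using (T)
open import Data.List using (List; []; _∷_; map)
open import Data.List.Membership.Propositional using (_∈_; find; lose)
open import Data.List.Membership.Propositional.Properties using (∈-filter⁺; ∈-filter⁻)
open import Data.List.Relation.Unary.All as All using (All; []; _∷_)
open import Data.List.Relation.Unary.Any using (Any; here; there)
open import Data.Bool.Properties using (T?)
open import Relation.Binary.PropositionalEquality using (refl)
open import Relation.Unary using (Decidable)

module _ (L : IOLTS) where
  open IOLTS L

  module _ {V : Set} {σ : V → S → Set} {p : S} where

    sat-⋀⁻ : {A : Set} (f : A → Form L V) (xs : List A) →
             sat L σ p (⋀ L (map f xs)) → All (λ a → sat L σ p (f a)) xs
    sat-⋀⁻ f []       _         = []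
    sat-⋀⁻ f (x ∷ xs) (px , ps) = px ∷ sat-⋀⁻ f xs ps

    sat-⋀⁺ : {A : Set} (f : A → Form L V) (xs : List A) →
             All (λ a → sat L σ p (f a)) xs → sat L σ p (⋀ L (map f xs))
    sat-⋀⁺ f []       []         = tt
    sat-⋀⁺ f (x ∷ xs) (px ∷ pxs) = px , sat-⋀⁺ f xs pxs

    sat-⋁-var⁻ : (xs : List V) → sat L σ p (⋁ L (map var xs)) → Any (λ X → σ X p) xs
    sat-⋁-var⁻ (x ∷ xs) (inj₁ px) = here px
    sat-⋁-var⁻ (x ∷ xs) (inj₂ ps) = there (sat-⋁-var⁻ xs ps)

    sat-⋁-var⁺ : (xs : List V) → Any (λ X → σ X p) xs → sat L σ p (⋁ L (map var xs))
    sat-⋁-var⁺ (x ∷ xs) (here px)  = inj₁ px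
    sat-⋁-var⁺ (x ∷ xs) (there ps) = inj₂ (sat-⋁-var⁺ xs ps)

  module _ (R : S → S → Set) {q : S} {a : Act I O} {p' : S} where

    sat-⋁-succs⁻ : sat L (σR L R) p' (⋁ L (map var (succs q a))) →
                   ∃ λ q' → (q ⟶[ a ] q') × R p' q'
    sat-⋁-succs⁻ h with q' , q'∈ , Rp'q' ← find (sat-⋁-var⁻ (succs q a) h) =
      q' , succs-sound q a q' q'∈ , Rp'q'

    sat-⋁-succs⁺ : ∃ (λ q' → (q ⟶[ a ] q') × R p' q') →
                   sat L (σR L R) p' (⋁ L (map var (succs q a)))
    sat-⋁-succs⁺ (q' , q⟶q' , Rp'q') =
      sat-⋁-var⁺ (succs q a) (lose (succs-complete q a q' q⟶q') Rp'q')

  nonEmpty⁺ : ∀ {x xs} → x ∈ xs → T (nonEmpty L xs)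
  nonEmpty⁺ (here _)  = tt
  nonEmpty⁺ (there _) = tt

  nonEmpty⁻ : ∀ {xs} → T (nonEmpty L xs) → ∃ λ x → x ∈ xs
  nonEmpty⁻ {x ∷ _} _ = x , here refl

  hasSucc? : (q : S) → Decidable (λ b → T (nonEmpty L (succs q (inj₁ b))))
  hasSucc? q b = T? (nonEmpty L (succs q (inj₁ b)))

  ∈-ins⁻ : ∀ {q a} → a ∈ ins L q → HasIn L q a
  ∈-ins⁻ {q} {a} a∈ins
    with q' , q'∈ ← nonEmpty⁻ (proj₂ (∈-filter⁻ (hasSucc? q) {xs = Ienum} a∈ins)) =
    q' , succs-sound q (inj₁ a) q' q'∈

  ∈-ins⁺ : ∀ {q a} → HasIn L q a → a ∈ ins L q
  ∈-ins⁺ {q} {a} (q' , q⟶q') =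
    ∈-filter⁺ (hasSucc? q) (Ienum-complete a) (nonEmpty⁺ (succs-complete q (inj₁ a) q' q⟶q'))

  module _ (R : S → S → Set) {p q : S} where

    Fio⇒charIO : Fio L R p q → sat L (σR L R) p (charIO L q)
    Fio⇒charIO (ins⊆ , inputs , outputs) =
        sat-⋀⁺ _ (ins L q) (All.tabulate λ a∈ins → let has = ∈-ins⁻ a∈ins in
          ins⊆ _ has , λ p' t → sat-⋁-succs⁺ R (inputs _ has p' t))
      , sat-⋀⁺ _ Oenum (All.tabulate λ _ p' t → sat-⋁-succs⁺ R (outputs _ p' t))

    charIO⇒Fio : sat L (σR L R) p (charIO L q) → Fio L R p q
    charIO⇒Fio (sat-ins , sat-outs) =
        (λ a has → proj₁ (input a has))
      , (λ a has p' t → sat-⋁-succs⁻ R (proj₂ (input a has) p' t))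
      , (λ o p' t → sat-⋁-succs⁻ R (output o p' t))
      where
      input : ∀ a → HasIn L q a →
              HasIn L p a × (∀ p' → p ⟶[ inj₁ a ] p' →
                             sat L (σR L R) p' (⋁ L (map var (succs q (inj₁ a)))))
      input a has = All.lookup (sat-⋀⁻ _ (ins L q) sat-ins) (∈-ins⁺ has)

      output : ∀ o p' → p ⟶[ inj₂ o ] p' → sat L (σR L R) p' (⋁ L (map var (succs q (inj₂ o))))
      output o = All.lookup (sat-⋀⁻ _ Oenum sat-outs) (Oenum-complete o)

lemma3 : (L : IOLTS) → (R : IOLTS.S L → IOLTS.S L → Set) → (p q : IOLTS.S L) →
    (Fio L R p q → sat L (σR L R) p (charIO L q))
    × (sat L (σR L R) p (charIO L q) → Fio L R p q)
lemma3 L R p q = Fio⇒charIO L R , charIO⇒Fio L R
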